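{- Let $F$ be a 2-CNF formula, $L$ a set of literals such that $SWRT(F,L)$ is true, and $w$ a walk of $F$ from $\neg L$. Then $F$ has a path $p$ with the same first and last literals as $w$ such that the set of clauses of $p$ is a subset of the set of clauses of $w$.
   Context: A literal is a Boolean variable or its negation; $\neg$ denotes negation, and for a set $L$ of literals $\neg L=\{\neg l': l'\in L\}$. $Var(\cdot)$ denotes the set of variables. A 2-CNF formula $F$ is a conjunction of clauses each consisting of exactly two literals (a one-literal clause $(l)$ is written $(l\vee l)$; $(l_1\vee l_2)$ and $(l_2\vee l_1)$ are the same clause), with pairwise distinct clauses. A set of literals is non-contradictory if it contains no literal and its negation. A satisfying assignment of $F$ is a non-contradictory set $P$ of literals with $Var(P)=Var(F)$ such that each clause of $F$ contains a literal of $P$. $SWRT(F,L)$ means $F$ has a satisfying assignment $P$ with $P\cap \neg L=\emptyset$. A walk of $F$ is a nonempty sequence $(C_1,\dots,C_q)$ of (not necessarily distinct) clauses of $F$ where in each entry one literal is designated the first literal and the other the second literal, such that for every $i<q$ the second literal of $C_i$ is the negation of the first literal of $C_{i+1}$. The first literal of the walk is the first literal of $C_1$ and its last literal is the second literal of $C_q$; the walk is from a set $M$ of literals if its first literal lies in $M$. A path of $F$ is a walk of $F$ whose clauses are pairwise distinct. -}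

module Defs where

open import Data.Nat using (ℕ)
open import Data.Bool using (Bool; not)
open import Data.Product using (_×_; _,_; Σ; ∃; ∃-syntax; proj₁; proj₂)
open import Data.Sum using (_⊎_)
open import Data.Empty using (⊥)
open import Data.List using (List; []; _∷_; last; head)
open import Data.List.Membership.Propositional using (_∈_)
open import Data.List.Relation.Unary.Any using (Any)
open import Data.List.Relation.Unary.All using (All)
open import Data.List.Relation.Unary.AllPairs using (AllPairs)
open import Data.Maybe using (just)
open import Relation.Nullary using (¬_)
open import Relation.Binary.PropositionalEquality using (_≡_)

-- Variables are natural numbers; a literal is a variable with a polarity
-- (true = positive, false = negated).
record Literal : Set where
  constructor lit
  field
    var : ℕ
    pos : Bool
open Literal public

neg : Literal → Literal
neg (lit x b) = lit x (not b)

LitSet : Set₁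
LitSet = Literal → Set

negSet : LitSet → LitSet
negSet L l = Σ Literal λ l' → L l' × l ≡ neg l'

-- A clause (l₁ ∨ l₂); a one-literal clause (l) is (l ∨ l).
-- Clauses are unordered: (l₁ ∨ l₂) and (l₂ ∨ l₁) are the same clause.
Clause : Set
Clause = Literal × Literal

SameClause : Clause → Clause → Set
SameClause (a , b) (c , d) = (a ≡ c × b ≡ d) ⊎ (a ≡ d × b ≡ c)

_∈C_ : Clause → List Clause → Set
c ∈C cs = Any (SameClause c) cs

Formula : Set
Formula = List Clause

WellFormed : Formula → Set
WellFormed F = AllPairs (λ c d → ¬ SameClause c d) F

InClause : Literal → Clause → Set
InClause l (a , b) = (l ≡ a) ⊎ (l ≡ b)

VarOfF : Formula → ℕ → Set
VarOfF F x = Σ Clause λ c → c ∈ F × Σ Literal λ l → InClause l c × var l ≡ x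

VarOfS : LitSet → ℕ → Set
VarOfS P x = Σ Literal λ l → P l × var l ≡ x

NonContradictory : LitSet → Set
NonContradictory P = (l : Literal) → P l → P (neg l) → ⊥

SatAssignment : Formula → LitSet → Set
SatAssignment F P =
  NonContradictory P ×
  ((x : ℕ) → (VarOfS P x → VarOfF F x) × (VarOfF F x → VarOfS P x)) ×
  All (λ c → Σ Literal λ l → InClause l c × P l) F

SWRT : Formula → LitSet → Set₁
SWRT F L = Σ LitSet λ P → SatAssignment F P × ((l : Literal) → P l → negSet L l → ⊥)

-- An entry of a walk: a clause of the formula with designated first literal
-- (proj₁) and second literal (proj₂).
OrientedClause : Set
OrientedClause = Literal × Literal

Chain : List OrientedClause → Set
Chain [] = Data.Unit.⊤ where import Data.Unit
Chain (c ∷ []) = Data.Unit.⊤ where import Data.Unit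
Chain (c ∷ d ∷ cs) = (proj₂ c ≡ neg (proj₁ d)) × Chain (d ∷ cs)

record Walk (F : Formula) : Set where
  constructor walk
  field
    entries  : List OrientedClause
    nonempty : ¬ (entries ≡ [])
    inF      : All (λ c → c ∈C F) entries
    chain    : Chain entries
open Walk public

FirstLit : {F : Formula} → Walk F → Literal → Set
FirstLit w l = Σ OrientedClause λ c → head (entries w) ≡ just c × proj₁ c ≡ l

LastLit : {F : Formula} → Walk F → Literal → Set
LastLit w l = Σ OrientedClause λ c → last (entries w) ≡ just c × proj₂ c ≡ l

SameEnds : {F : Formula} → Walk F → Walk F → Set
SameEnds p w = Σ Literal λ a → Σ Literal λ b →
  FirstLit p a × FirstLit w a × LastLit p b × LastLit w b

WalkFrom : {F : Formula} → Walk F → LitSet → Set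
WalkFrom w M = Σ Literal λ l → FirstLit w l × M l

IsPath : {F : Formula} → Walk F → Set
IsPath w = AllPairs (λ c d → ¬ SameClause c d) (entries w)

ClausesSubset : {F : Formula} → Walk F → Walk F → Set
ClausesSubset p w = All (λ c → c ∈C entries w) (entries p)

module Submission where

-- Fix a satisfying assignment P of F avoiding ¬L.  The first
-- literal l of the walk lies in ¬L, so P does not contain l; since var l
-- occurs in F, P contains ¬l.  Each clause of F is satisfied by P, so a
-- clause whose first literal is false has a true second literal, and the
-- chaining condition passes the falsity on to the next first literal.  Hence
-- every entry of the walk is *forced*: first literal false, second true.
-- Forced entries of the same clause have the same orientation (the reverse
-- orientation would make a literal both true and false), i.e. the walk is
-- *rigid*.  For rigid walks plain loop erasure works: scanning from the back,
-- whenever the current entry already occurs in the erased remainder, jump to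
-- that occurrence.

open import Defs
open import Data.Product using (Σ; _×_; _,_; proj₁; proj₂)
open import Data.Sum using (_⊎_; inj₁; inj₂)
open import Data.Empty using (⊥-elim)
open import Data.Unit using (tt)
open import Data.Bool using (true; false)
import Data.Bool as Bool
import Data.Nat as Nat
open import Data.List using (List; []; _∷_; last)
open import Data.Maybe using (just)
open import Data.List.Membership.Propositional using (_∈_; find)
open import Data.List.Relation.Unary.Any using (Any; here; there; any?)
import Data.List.Relation.Unary.Any as Any
open import Data.List.Relation.Unary.All using (All; []; _∷_; lookup)
import Data.List.Relation.Unary.All as All
open import Data.List.Relation.Unary.All.Properties using (¬Any⇒All¬)
open import Data.List.Relation.Unary.AllPairs using (AllPairs; []; _∷_)
open import Data.List.Relation.Binary.Subset.Propositional using (_⊆_)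
open import Data.List.Relation.Binary.Subset.Propositional.Properties using (∷⁺ʳ)
open import Function using (_∘_; id)
open import Relation.Nullary using (¬_; Dec; yes; no)
open import Relation.Nullary.Decidable using (_×-dec_; _⊎-dec_)
open import Relation.Binary.PropositionalEquality using (_≡_; refl; sym; trans; subst; cong)

_≟L_ : (a b : Literal) → Dec (a ≡ b)
lit x b ≟L lit y c with x Nat.≟ y | b Bool.≟ c
... | yes refl | yes refl = yes refl
... | no x≢y   | _        = no λ { refl → x≢y refl }
... | yes _    | no b≢c   = no λ { refl → b≢c refl }

sameClause? : (c d : Clause) → Dec (SameClause c d)
sameClause? (a , b) (c , d) =
  ((a ≟L c) ×-dec (b ≟L d)) ⊎-dec ((a ≟L d) ×-dec (b ≟L c))

sameClause-sym : ∀ {c d} → SameClause c d → SameClause d c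
sameClause-sym (inj₁ (refl , refl)) = inj₁ (refl , refl)
sameClause-sym (inj₂ (refl , refl)) = inj₂ (refl , refl)

inClause-transfer : ∀ {l c d} → SameClause c d → InClause l c → InClause l d
inClause-transfer (inj₁ (refl , refl)) l∈c = l∈c
inClause-transfer (inj₂ (refl , refl)) (inj₁ e) = inj₂ e
inClause-transfer (inj₂ (refl , refl)) (inj₂ e) = inj₁ e

same-var : (m l : Literal) → var m ≡ var l → (m ≡ l) ⊎ (m ≡ neg l)
same-var (lit x false) (lit .x false) refl = inj₁ refl
same-var (lit x false) (lit .x true)  refl = inj₂ refl
same-var (lit x true)  (lit .x false) refl = inj₂ refl
same-var (lit x true)  (lit .x true)  refl = inj₁ refl

∈⇒∈C : ∀ {e : OrientedClause} {xs} → e ∈ xs → e ∈C xs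
∈⇒∈C = Any.map λ { refl → inj₁ (refl , refl) }

last-exists : (c : OrientedClause) (cs : List OrientedClause) →
              Σ OrientedClause λ x → last (c ∷ cs) ≡ just x
last-exists c []       = c , refl
last-exists c (d ∷ ds) = last-exists d ds

Distinct : List OrientedClause → Set
Distinct = AllPairs (λ c d → ¬ SameClause c d)

Rigid : List OrientedClause → Set
Rigid xs = ∀ {x y} → x ∈ xs → y ∈ xs → SameClause x y → x ≡ y

rigid-⊆ : ∀ {xs ys} → ys ⊆ xs → Rigid xs → Rigid ys
rigid-⊆ ys⊆xs rigid x∈ y∈ = rigid (ys⊆xs x∈) (ys⊆xs y∈)

rigid-member : ∀ {c xs ys} → Rigid xs → c ∈ xs → ys ⊆ xs →
               Any (SameClause c) ys → c ∈ ys
rigid-member rigid c∈xs ys⊆xs same with find same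
... | y , y∈ys , c~y with rigid c∈xs (ys⊆xs y∈ys) c~y
...   | refl = y∈ys

suffix-from : ∀ {c d ds} → c ∈ d ∷ ds → Chain (d ∷ ds) → Distinct (d ∷ ds) →
  Σ (List OrientedClause) λ es →
    last (c ∷ es) ≡ last (d ∷ ds) × Chain (c ∷ es) × Distinct (c ∷ es) ×
    (c ∷ es) ⊆ (d ∷ ds)
suffix-from {ds = ds} (here refl) chain distinct = ds , refl , chain , distinct , id
suffix-from {ds = _ ∷ _} (there c∈) (_ , chain) (_ ∷ distinct)
  with suffix-from c∈ chain distinct
... | es , same-last , chain′ , distinct′ , sub = es , same-last , chain′ , distinct′ , there ∘ sub

record LoopFree (c : OrientedClause) (cs : List OrientedClause) : Set where
  constructor loopFree
  field
    first      : OrientedClause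
    rest       : List OrientedClause
    same-first : proj₁ first ≡ proj₁ c
    same-last  : last (first ∷ rest) ≡ last (c ∷ cs)
    chained    : Chain (first ∷ rest)
    distinct   : Distinct (first ∷ rest)
    entries⊆   : (first ∷ rest) ⊆ (c ∷ cs)

-- Loop erasure: erase the tail first; if the head's clause reappears there,
-- rigidity makes it the same entry and we continue from that occurrence,
-- otherwise we prepend the head.
loop-erase : ∀ c cs → Chain (c ∷ cs) → Rigid (c ∷ cs) → LoopFree c cs
loop-erase c [] _ _ = loopFree c [] refl refl tt ([] ∷ []) id
loop-erase c (c′ ∷ cs) (link , chain) rigid
  with loop-erase c′ cs chain (rigid-⊆ there rigid)
... | loopFree d ds d₁≡c′₁ same-last chain′ distinct sub
  with any? (sameClause? c) (d ∷ ds)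
...   | yes repeated =
  let c∈ = rigid-member rigid (here refl) (there ∘ sub) repeated
      es , same-last′ , chain″ , distinct′ , sub′ = suffix-from c∈ chain′ distinct
  in loopFree c es refl (trans same-last′ same-last) chain″ distinct′ (there ∘ sub ∘ sub′)
...   | no fresh =
  loopFree c (d ∷ ds) refl same-last
           (trans link (cong neg (sym d₁≡c′₁)) , chain′)
           (¬Any⇒All¬ (d ∷ ds) fresh ∷ distinct)
           (∷⁺ʳ c sub)

Forced : LitSet → OrientedClause → Set
Forced P e = P (neg (proj₁ e)) × P (proj₂ e)

forced-rigid : ∀ {P xs} → NonContradictory P → All (Forced P) xs → Rigid xs
forced-rigid nc forced x∈ y∈ (inj₁ (refl , refl)) = refl
forced-rigid nc forced {x , _} x∈ y∈ (inj₂ (refl , refl)) =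
  ⊥-elim (nc x (proj₂ (lookup forced y∈)) (proj₁ (lookup forced x∈)))

second-literal-true : ∀ {F P} → SatAssignment F P → (e : OrientedClause) →
                      e ∈C F → P (neg (proj₁ e)) → P (proj₂ e)
second-literal-true {F} {P} (nc , _ , satisfied) e e∈F first-false
  with All.lookupWith {R = λ _ → Σ Literal λ l → InClause l e × P l}
         (λ { (l , l∈d , Pl) e~d → l , inClause-transfer (sameClause-sym e~d) l∈d , Pl })
         satisfied e∈F
... | l , inj₁ refl , Pl = ⊥-elim (nc l Pl first-false)
... | l , inj₂ refl , Pl = Pl

chain-forced : ∀ {F P} → SatAssignment F P → ∀ e es → P (neg (proj₁ e)) →
               Chain (e ∷ es) → All (_∈C F) (e ∷ es) → All (Forced P) (e ∷ es)
chain-forced sat e [] first-false _ (e∈F ∷ []) =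
  (first-false , second-literal-true sat e e∈F first-false) ∷ []
chain-forced {P = P} sat e (e′ ∷ es) first-false (link , chain) (e∈F ∷ es∈F) =
  (first-false , second-true) ∷ chain-forced sat e′ es (subst P link second-true) chain es∈F
  where
  second-true : P (proj₂ e)
  second-true = second-literal-true sat e e∈F first-false

first-var-of : ∀ {F} (e : OrientedClause) → e ∈C F → VarOfF F (var (proj₁ e))
first-var-of e e∈F with find e∈F
... | d , d∈F , e~d = d , d∈F , proj₁ e , inClause-transfer e~d (inj₁ refl) , refl

assignment-decides : ∀ {F P} → SatAssignment F P → (l : Literal) →
                     VarOfF F (var l) → P l ⊎ P (neg l)
assignment-decides (_ , covers , _) l v with proj₂ (covers (var l)) v
... | m , Pm , m≈l with same-var m l m≈l
...   | inj₁ refl = inj₁ Pm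
...   | inj₂ refl = inj₂ Pm

lemma3 : (F : Formula) → WellFormed F → (L : LitSet) → SWRT F L →
    (w : Walk F) → WalkFrom w (negSet L) →
    Σ (Walk F) λ p → IsPath p × SameEnds p w × ClausesSubset p w
lemma3 F _ L _ (walk [] nonempty _ _) _ = ⊥-elim (nonempty refl)
lemma3 F _ L (P , sat@(nc , _ , _) , avoids) w@(walk (c ∷ cs) _ inF chn)
       (l , (.c , refl , refl) , l∈¬L) =
  path , distinct , ends , All.tabulate (∈⇒∈C ∘ entries⊆)
  where
  first-false : P (neg l)
  first-false with assignment-decides sat l (first-var-of c (All.head inF))
  ... | inj₁ Pl  = ⊥-elim (avoids l Pl l∈¬L)
  ... | inj₂ P¬l = P¬l

  erased : LoopFree c cs
  erased = loop-erase c cs chn (forced-rigid nc (chain-forced sat c cs first-false chn inF))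
  open LoopFree erased

  path : Walk F
  path = walk (first ∷ rest) (λ ()) (All.tabulate (lookup inF ∘ entries⊆)) chained

  ends : SameEnds path w
  ends with last-exists c cs
  ... | x , last≡x = l , proj₂ x , (first , refl , same-first) , (c , refl , refl)
                   , (x , trans same-last last≡x , refl) , (x , last≡x , refl)
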